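{- For every integer $i\ge 1$, $\mathrm{PL}^i\subsetneq\mathrm{PL}^{i+1}$.
   Context: A random-access Turing machine (RATM) is a Turing machine with $k\ge 2$ ordinary tapes (a read-only input tape, an output tape and work tapes), each equipped with its own write-only binary index tape; in each step it reads the symbols under the ordinary heads, writes on the writable ordinary tapes and on the index tapes, moves all heads, and changes state; when it enters a special random-access state $q_a$, the heads of all ordinary tapes jump (in that step) to the cells whose addresses are written in binary on the respective index tapes. Running time is the number of steps. For $i\ge 1$, $\mathrm{PL}^i$ is the class of decision problems solvable by a RATM in time $O(\log^i n)$, where $n$ is the input length. -}

module Defs where

open import Data.Nat using (ℕ; zero; suc; _+_; _*_; _^_; _≤_)
open import Data.Nat.Logarithm using (⌊log₂_⌋)
open import Data.Bool using (Bool; true; false; if_then_else_)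
open import Data.Maybe using (Maybe; just; nothing; maybe)
open import Data.Fin using (Fin)
import Data.Fin as Fin
open import Data.List using (List; []; _∷_; length)
open import Data.Vec using (Vec; _∷_; replicate; zipWith; map; head; tail)
import Data.Nat as Nat
open import Data.Product using (Σ; ∃; _×_; _,_)
open import Relation.Nullary using (does)
open import Relation.Binary.PropositionalEquality using (_≡_)

data Move : Set where
  mL mS mR : Move

move : Move → ℕ → ℕ
move mL zero    = zero
move mL (suc p) = p
move mS p       = p
move mR p       = suc p

cellAt : {A : Set} → List A → ℕ → Maybe A
cellAt []       _       = nothing
cellAt (a ∷ _)  zero    = just a
cellAt (_ ∷ as) (suc p) = cellAt as p

-- index tape: cells 0,1,2,... holding 0/1 or blank (nothing);
-- represented by the finite visited prefix, blank beyond
writeAt : List (Maybe Bool) → ℕ → Maybe Bool → List (Maybe Bool)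
writeAt []       zero    b = b ∷ []
writeAt []       (suc p) b = nothing ∷ writeAt [] p b
writeAt (_ ∷ xs) zero    b = b ∷ xs
writeAt (x ∷ xs) (suc p) b = x ∷ writeAt xs p b

bit : Bool → ℕ
bit false = 0
bit true  = 1

-- the binary number written on an index tape: the maximal blank-free
-- prefix starting at cell 0, most significant bit first (empty = 0)
addrFrom : ℕ → List (Maybe Bool) → ℕ
addrFrom acc []             = acc
addrFrom acc (nothing ∷ _)  = acc
addrFrom acc (just b ∷ xs)  = addrFrom (2 * acc + bit b) xs

address : List (Maybe Bool) → ℕ
address = addrFrom 0

updateTape : {A : Set} → (ℕ → Maybe A) → ℕ → Maybe A → (ℕ → Maybe A)
updateTape f p a q = if q Nat.≡ᵇ p then a else f q

-- Ordinary tapes: tape 0 = read-only input tape, tape 1 = output tape,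
-- tapes 2 .. w+1 = work tapes; so k = 2 + w ≥ 2 ordinary tapes.
-- Writable tapes (output + work) are the suc w tapes of the vectors below.
-- Each of the 2 + w ordinary tapes has a write-only binary index tape.

record Action (nQ γ w : ℕ) : Set where
  field
    next   : Fin nQ
    writes : Vec (Maybe (Fin γ)) (suc w)
    moves  : Vec Move (suc (suc w))               -- ordinary head moves (input first)
    iwrite : Vec (Maybe (Maybe Bool)) (suc (suc w)) -- index tape writes (nothing = no write)
    imoves : Vec Move (suc (suc w))

record RATM (s : ℕ) : Set where
  field
    w     : ℕ
    nQ    : ℕ
    γ     : ℕ                 -- non-blank symbols of output/work tapes
    start : Fin nQ
    qa    : Fin nQ            -- the random-access state
    halt  : Fin nQ → Maybe Bool   -- just b : halting state with answer b
    δ     : Fin nQ → Maybe (Fin s) → Vec (Maybe (Fin γ)) (suc w) → Action nQ γ w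

module Run {s : ℕ} (M : RATM s) where
  open RATM M

  record Config : Set where
    field
      state  : Fin nQ
      ihead  : ℕ
      tapes  : Vec (ℕ → Maybe (Fin γ)) (suc w)
      heads  : Vec ℕ (suc w)
      itapes : Vec (List (Maybe Bool)) (suc (suc w))
      iheads : Vec ℕ (suc (suc w))

  open Config

  init : List (Fin s) → Config
  init x = record
    { state  = start
    ; ihead  = 0
    ; tapes  = replicate _ (λ _ → nothing)
    ; heads  = replicate _ 0
    ; itapes = replicate _ []
    ; iheads = replicate _ 0
    }

  doStep : List (Fin s) → Config → Config
  doStep x c = record
    { state  = Action.next a
    ; ihead  = head newHeads
    ; tapes  = zipWith (λ t hw → t hw) (zipWith updateTape (tapes c) (heads c)) (Action.writes a)
    ; heads  = tail newHeads
    ; itapes = itapes′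
    ; iheads = zipWith move (Action.imoves a) (iheads c)
    }
    where
    a : Action nQ γ w
    a = δ (state c) (cellAt x (ihead c)) (zipWith (λ t h → t h) (tapes c) (heads c))
    itapes′ : Vec (List (Maybe Bool)) (suc (suc w))
    itapes′ = zipWith (λ th mb → maybe (λ b → writeAt (Data.Product.proj₁ th) (Data.Product.proj₂ th) b) (Data.Product.proj₁ th) mb)
                      (zipWith _,_ (itapes c) (iheads c)) (Action.iwrite a)
    newHeads : Vec ℕ (suc (suc w))
    newHeads = if does (Action.next a Fin.≟ qa)
               then map address itapes′
               else zipWith move (Action.moves a) (ihead c ∷ heads c)

  step : List (Fin s) → Config → Config
  step x c with halt (Config.state c)
  ... | just _  = c
  ... | nothing = doStep x c

  run : List (Fin s) → ℕ → Config → Config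
  run x zero    c = c
  run x (suc t) c = run x t (step x c)

  result : List (Fin s) → ℕ → Maybe Bool
  result x t = halt (Config.state (run x t (init x)))

Problem : ℕ → Set
Problem s = List (Fin s) → Bool

Decides : {s : ℕ} → RATM s → Problem s → Set
Decides M P = ∀ x → Σ ℕ (λ t → Run.result M x t ≡ just (P x))

TimeLog : {s : ℕ} → ℕ → RATM s → Problem s → Set
TimeLog i M P = Σ ℕ λ c → Σ ℕ λ N → ∀ x → N ≤ length x →
  Run.result M x (c * ⌊log₂ length x ⌋ ^ i) ≡ just (P x)

PL : ℕ → {s : ℕ} → Problem s → Set
PL i {s} P = Σ (RATM s) λ M → Decides M P × TimeLog i M P

-- A bound c·log^i n is also a bound c·log^(i+1) n as soon as log n ≥ 1, which gives the inclusion.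
-- For strictness, note that a run of T steps reads at most T input cells: a problem with arbitrarily
-- long inputs x and more than c·log^i |x| positions each of which alone flips the answer is not in
-- PL^i.  Such a problem in PL^(i+1) is decided by a machine with i work tapes that computes
-- R ≈ log n with random accesses to 2, 4, 8, …, then uses its i + 1 writable tapes as an odometer
-- counting (R + 1)^(i+1) steps, scanning that many input cells from position 2^(R-1) and rejecting
-- on a 0.  On the all-ones input of length 2^(k+1) every one of the first (k+1)^(i+1) > c·(k+1)^i
-- cells of this window flips the answer.
module Submission where

open import Defs
open import Data.Nat
  using (ℕ; zero; suc; NonZero; _+_; _*_; _∸_; _^_; _≤_; _<_; z≤n; s≤s; z<s; s<s; _≡ᵇ_; _<ᵇ_; pred; _<?_; _⊔_;
         >-nonZero; >-nonZero⁻¹)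
open import Data.Nat.Properties
open import Data.Nat.Tactic.RingSolver using (solve-∀)
open import Data.Nat.DivMod using (_/_; _%_; m≡m%n+[m/n]*n; m%n<n; m<n*o⇒m/o<n)
open import Data.Nat.Logarithm using (⌊log₂_⌋; ⌊log₂⌋-mono-≤; ⌊log₂[2^n]⌋≡n)
open import Data.Bool using (Bool; true; false; if_then_else_; _∧_; T)
open import Data.Maybe using (Maybe; just; nothing; maybe; fromMaybe)
open import Data.Maybe.Properties using (just-injective)
open import Data.Fin using (Fin; toℕ)
import Data.Fin as Fin
import Data.Fin.Properties as Finₚ
open import Data.List using (List; []; _∷_; length)
import Data.List as List
open import Data.List.Properties using (length-replicate)
open import Data.List.Membership.Propositional using (_∈_; _∉_)
open import Data.List.Membership.DecPropositional _≟_ using (_∈?_)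
open import Data.List.Relation.Unary.Any using (here; there; index)
open import Data.List.Relation.Unary.Any.Properties using (lookup-index)
open import Data.Vec using (Vec; []; _∷_; replicate; zipWith; map; head; tail)
open import Data.Vec.Properties using (map-replicate; zipWith-replicate)
open import Data.Product using (Σ; ∃; _×_; _,_; proj₁; proj₂)
open import Data.Sum using (_⊎_; inj₁; inj₂)
open import Data.Unit using (⊤; tt)
open import Data.Empty using (⊥-elim)
open import Relation.Nullary using (¬_; yes; no; does)
open import Relation.Binary.PropositionalEquality

writeIndices : ∀ {n} → Vec (List (Maybe Bool)) n → Vec ℕ n → Vec (Maybe (Maybe Bool)) n → Vec (List (Maybe Bool)) n
writeIndices its ihs =
  zipWith (λ th mb → maybe (λ b → writeAt (proj₁ th) (proj₂ th) b) (proj₁ th) mb) (zipWith _,_ its ihs)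

Tape : ℕ → Set
Tape γ = ℕ → Maybe (Fin γ)

scan : ∀ {γ k} → Vec (Tape γ) k → Vec ℕ k → Vec (Maybe (Fin γ)) k
scan = zipWith (λ t h → t h)

overwrite : ∀ {γ k} → Vec (Tape γ) k → Vec ℕ k → Vec (Maybe (Fin γ)) k → Vec (Tape γ) k
overwrite ts hs = zipWith (λ t hw → t hw) (zipWith updateTape ts hs)

module RunProperties {s : ℕ} (M : RATM s) where
  open RATM M
  open Run M
  open Config

  -- Run.doStep with the action as a parameter.
  perform : Config → Action nQ γ w → Config
  perform c a = record
    { state  = Action.next a
    ; ihead  = head newHeads
    ; tapes  = overwrite (tapes c) (heads c) (Action.writes a)
    ; heads  = tail newHeads
    ; itapes = itapes′
    ; iheads = zipWith move (Action.imoves a) (iheads c)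
    }
    where
    itapes′ : Vec (List (Maybe Bool)) (suc (suc w))
    itapes′ = writeIndices (itapes c) (iheads c) (Action.iwrite a)
    newHeads : Vec ℕ (suc (suc w))
    newHeads = if does (Action.next a Fin.≟ qa)
               then map address itapes′
               else zipWith move (Action.moves a) (ihead c ∷ heads c)

  scanned : Config → Vec (Maybe (Fin γ)) (suc w)
  scanned c = scan (tapes c) (heads c)

  step-running : ∀ x c → halt (state c) ≡ nothing →
                 step x c ≡ perform c (δ (state c) (cellAt x (ihead c)) (scanned c))
  step-running x c eq with halt (state c) | eq
  ... | nothing | refl = refl

  step-halted : ∀ x c {b} → halt (state c) ≡ just b → step x c ≡ c
  step-halted x c eq with halt (state c) | eq
  ... | just _ | refl = refl

  run-+ : ∀ x a b c → run x (a + b) c ≡ run x b (run x a c)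
  run-+ x zero    b c = refl
  run-+ x (suc a) b c = run-+ x a b (step x c)

  run-suc : ∀ x t c → run x (suc t) c ≡ step x (run x t c)
  run-suc x t c = trans (cong (λ k → run x k c) (+-comm 1 t)) (run-+ x t 1 c)

  run-halted : ∀ x t c {b} → halt (state c) ≡ just b → run x t c ≡ c
  run-halted x zero    c eq = refl
  run-halted x (suc t) c eq rewrite step-halted x c eq = run-halted x t c eq

  verdict : Config → Maybe Bool
  verdict c = halt (state c)

  result-mono : ∀ x {t t′ b} → result x t ≡ just b → t ≤ t′ → result x t′ ≡ just b
  result-mono x {t} {t′} eq t≤t′ = begin
    result x t′                                   ≡⟨ cong (λ k → result x k) (m+[n∸m]≡n t≤t′) ⟨
    verdict (run x (t + (t′ ∸ t)) (init x))       ≡⟨ cong verdict (run-+ x t (t′ ∸ t) (init x)) ⟩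
    verdict (run x (t′ ∸ t) (run x t (init x)))   ≡⟨ cong verdict (run-halted x (t′ ∸ t) _ eq) ⟩
    result x t                                    ≡⟨ eq ⟩
    just _                                        ∎
    where open ≡-Reasoning

  result-unique : ∀ x {t₁ t₂ b₁ b₂} → result x t₁ ≡ just b₁ → result x t₂ ≡ just b₂ → b₁ ≡ b₂
  result-unique x {t₁} {t₂} e₁ e₂ =
    just-injective (trans (sym (result-mono x e₁ (m≤m+n t₁ t₂))) (result-mono x e₂ (m≤n+m t₂ t₁)))

  inputPositions : List (Fin s) → ℕ → Config → List ℕ
  inputPositions x zero    c = []
  inputPositions x (suc t) c = ihead c ∷ inputPositions x t (step x c)

  length-inputPositions : ∀ x t c → length (inputPositions x t c) ≡ t
  length-inputPositions x zero    c = refl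
  length-inputPositions x (suc t) c = cong suc (length-inputPositions x t (step x c))

  step-cong-input : ∀ x y c → cellAt x (ihead c) ≡ cellAt y (ihead c) → step x c ≡ step y c
  step-cong-input x y c eq with halt (state c)
  ... | just _  = refl
  ... | nothing = cong (λ v → perform c (δ (state c) v (scanned c))) eq

  run-cong-input : ∀ x y t c → (∀ p → p ∈ inputPositions x t c → cellAt x p ≡ cellAt y p) →
                   run x t c ≡ run y t c
  run-cong-input x y zero    c agree = refl
  run-cong-input x y (suc t) c agree
    rewrite sym (step-cong-input x y c (agree (ihead c) (here refl))) =
    run-cong-input x y t (step x c) (λ p p∈ → agree p (there p∈))

window⊈ : (ℓ : List ℕ) (base K : ℕ) → length ℓ < K → ¬ (∀ (t : Fin K) → toℕ t + base ∈ ℓ)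
window⊈ ℓ base K ∣ℓ∣<K window⊆ℓ with Finₚ.pigeonhole ∣ℓ∣<K (λ t → index (window⊆ℓ t))
... | i , j , i<j , same-index = <-irrefl (cong toℕ i≡j) i<j
  where
  i≡j : i ≡ j
  i≡j = Finₚ.toℕ-injective (+-cancelʳ-≡ base _ _
          (trans (lookup-index (window⊆ℓ i))
            (trans (cong (List.lookup ℓ) same-index) (sym (lookup-index (window⊆ℓ j))))))

∃-∉-window : (ℓ : List ℕ) (base K : ℕ) → length ℓ < K → ∃ λ t → t < K × t + base ∉ ℓ
∃-∉-window ℓ base K ∣ℓ∣<K
  with Finₚ.¬∀⟶∃¬ K (λ (t : Fin K) → toℕ t + base ∈ ℓ) (λ t → toℕ t + base ∈? ℓ)
                    (window⊈ ℓ base K ∣ℓ∣<K)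
... | t , t∉ℓ = toℕ t , Finₚ.toℕ<n t , t∉ℓ

SensitiveBeyond : ∀ {s} → ℕ → Problem s → Set
SensitiveBeyond {s} i P = ∀ c N → Σ (List (Fin s)) λ x → N ≤ length x × Σ ℕ λ base → Σ ℕ λ K →
  c * ⌊log₂ length x ⌋ ^ i < K ×
  (∀ t → t < K → Σ (List (Fin s)) λ y → length y ≡ length x × ¬ P y ≡ P x ×
                  (∀ p → p ≢ t + base → cellAt x p ≡ cellAt y p))

module _ {s} (M : RATM s) where
  open Run M
  open RunProperties M

  short-run-misses-window : ∀ x T base K → T < K →
    ∃ λ t → t < K × ∀ y → (∀ p → p ≢ t + base → cellAt x p ≡ cellAt y p) → result x T ≡ result y T
  short-run-misses-window x T base K T<K
    with ∃-∉-window (inputPositions x T (init x)) base K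
           (subst (_< K) (sym (length-inputPositions x T (init x))) T<K)
  ... | t , t<K , unread = t , t<K , λ y agree →
    cong verdict (run-cong-input x y T (init x) (λ p p∈ → agree p (λ p≡ → unread (subst (_∈ _) p≡ p∈))))

SensitiveBeyond⇒¬PL : ∀ {s} i (P : Problem s) → SensitiveBeyond i P → ¬ PL i P
SensitiveBeyond⇒¬PL i P sensitive (M , _ , c , N , fast) with sensitive c N
... | x , N≤∣x∣ , base , K , T<K , flip with short-run-misses-window M x _ base K T<K
... | t , t<K , irrelevant with flip t t<K
... | y , ∣y∣≡∣x∣ , Py≢Px , agree = Py≢Px (just-injective (begin
    just (P y)       ≡⟨ fast-y ⟨
    result y τ       ≡⟨ irrelevant y agree ⟨
    result x τ       ≡⟨ fast x N≤∣x∣ ⟩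
    just (P x)       ∎))
  where
  open Run M
  open ≡-Reasoning
  τ = c * ⌊log₂ length x ⌋ ^ i
  fast-y : result y τ ≡ just (P y)
  fast-y = subst (λ n → result y (c * ⌊log₂ n ⌋ ^ i) ≡ just (P y)) ∣y∣≡∣x∣
             (fast y (subst (N ≤_) (sym ∣y∣≡∣x∣) N≤∣x∣))

1≤⌊log₂⌋ : ∀ {n} → 2 ≤ n → 1 ≤ ⌊log₂ n ⌋
1≤⌊log₂⌋ {n} 2≤n = subst (_≤ ⌊log₂ n ⌋) (⌊log₂[2^n]⌋≡n 1) (⌊log₂⌋-mono-≤ 2≤n)

^-monoʳ-suc : ∀ {L} i → 1 ≤ L → L ^ i ≤ L ^ suc i
^-monoʳ-suc {L} i 1≤L = subst (_≤ L * L ^ i) (*-identityˡ (L ^ i)) (*-monoˡ-≤ (L ^ i) 1≤L)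

PL⊆PL-suc : ∀ i {s} (P : Problem s) → PL i P → PL (suc i) P
PL⊆PL-suc i P (M , decides , c , N , fast) = M , decides , c , N ⊔ 2 , λ x N⊔2≤∣x∣ →
  RunProperties.result-mono M x (fast x (≤-trans (m≤m⊔n N 2) N⊔2≤∣x∣))
    (*-monoʳ-≤ c (^-monoʳ-suc i (1≤⌊log₂⌋ (≤-trans (m≤n⊔m N 2) N⊔2≤∣x∣))))

Sym : Set
Sym = Fin 3

pattern searchEnd = Fin.zero
pattern clockEnd  = Fin.suc Fin.zero
pattern mark      = Fin.suc (Fin.suc Fin.zero)

atBoundary : Maybe Sym → Bool
atBoundary (just mark) = false
atBoundary _           = true

allAtBoundary : ∀ {k} → Vec (Maybe Sym) k → Bool
allAtBoundary []       = true
allAtBoundary (r ∷ rs) = allAtBoundary rs ∧ atBoundary r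

-- A head sweeps a block of marks and turns round at either end; the Bool is its direction
-- (true = rightwards).
bounce : Maybe Sym → Bool → Move
bounce nothing     _ = mL
bounce (just mark) b = if b then mR else mL
bounce (just _)    _ = mR

bounceDir : Maybe Sym → Bool → Bool
bounceDir nothing     _ = false
bounceDir (just mark) b = b
bounceDir (just _)    _ = true

-- A head moves only when every later head stands at a boundary: the heads form an odometer.
odometerMoves : ∀ {k} → Vec (Maybe Sym) k → Vec Bool k → Vec Move k
odometerMoves []       []       = []
odometerMoves (r ∷ rs) (b ∷ bs) = (if allAtBoundary rs then bounce r b else mS) ∷ odometerMoves rs bs

odometerDirs : ∀ {k} → Vec (Maybe Sym) k → Vec Bool k → Vec Bool k
odometerDirs []       []       = []
odometerDirs (r ∷ rs) (b ∷ bs) = (if allAtBoundary rs then bounceDir r b else b) ∷ odometerDirs rs bs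

<⇒<ᵇ≡true : ∀ {a b} → a < b → (a <ᵇ b) ≡ true
<⇒<ᵇ≡true {zero}  {suc b} _         = refl
<⇒<ᵇ≡true {suc a} {suc b} (s<s a<b) = <⇒<ᵇ≡true a<b

≥⇒<ᵇ≡false : ∀ {a b} → b ≤ a → (a <ᵇ b) ≡ false
≥⇒<ᵇ≡false {a}     {zero}  _         = refl
≥⇒<ᵇ≡false {suc a} {suc b} (s≤s b≤a) = ≥⇒<ᵇ≡false b≤a

<ᵇ-suc : ∀ q r → (q ≡ᵇ r) ≡ false → (q <ᵇ r) ≡ (q <ᵇ suc r)
<ᵇ-suc zero    zero    ()
<ᵇ-suc zero    (suc r) _  = refl
<ᵇ-suc (suc q) zero    _  = refl
<ᵇ-suc (suc q) (suc r) eq = <ᵇ-suc q r eq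

module Clock (m : ℕ) where

  clockTape : ℕ → Maybe Sym
  clockTape zero    = just clockEnd
  clockTape (suc q) = if q <ᵇ m then just mark else nothing

  Heads : ℕ → Set
  Heads k = Vec ℕ k × Vec Bool k

  tick : ∀ {k} → Heads k → Heads k
  tick (ps , ds) = zipWith move (odometerMoves (map clockTape ps) ds) ps , odometerDirs (map clockTape ps) ds

  ticks : ∀ {k} → ℕ → Heads k → Heads k
  ticks zero    u = u
  ticks (suc t) u = ticks t (tick u)

  settled : ∀ {k} → Heads k → Bool
  settled (ps , _) = allAtBoundary (map clockTape ps)

  push : ∀ {k} → ℕ × Bool → Heads k → Heads (suc k)
  push (p , b) (ps , ds) = p ∷ ps , b ∷ ds

  bounce₁ : ℕ × Bool → ℕ × Bool
  bounce₁ (p , b) = move (bounce (clockTape p) b) p , bounceDir (clockTape p) b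

  bounces : ℕ → ℕ × Bool → ℕ × Bool
  bounces zero    h = h
  bounces (suc q) h = bounces q (bounce₁ h)

  ticks-+ : ∀ {k} a b (u : Heads k) → ticks (a + b) u ≡ ticks b (ticks a u)
  ticks-+ zero    b u = refl
  ticks-+ (suc a) b u = ticks-+ a b (tick u)

  ticks-suc : ∀ {k} t (u : Heads k) → ticks (suc t) u ≡ tick (ticks t u)
  ticks-suc t u = trans (cong (λ z → ticks z u) (+-comm 1 t)) (ticks-+ t 1 u)

  tick-push-unsettled : ∀ {k} h (u : Heads k) → settled u ≡ false → tick (push h u) ≡ push h (tick u)
  tick-push-unsettled (p , b) (ps , ds) eq rewrite eq = refl

  tick-push-settled : ∀ {k} h (u : Heads k) → settled u ≡ true → tick (push h u) ≡ push (bounce₁ h) (tick u)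
  tick-push-settled (p , b) (ps , ds) eq rewrite eq = refl

  ticks-push-unsettled : ∀ {k} t h (u : Heads k) → (∀ j → j < t → settled (ticks j u) ≡ false) →
                         ticks t (push h u) ≡ push h (ticks t u)
  ticks-push-unsettled zero    h u unsettled = refl
  ticks-push-unsettled (suc t) h u unsettled rewrite tick-push-unsettled h u (unsettled 0 z<s) =
    ticks-push-unsettled t h (tick u) (λ j j<t → unsettled (suc j) (s<s j<t))

  Boundary : ℕ → Set
  Boundary p = p ≡ 0 ⊎ p ≡ suc m

  AllBoundary : ∀ {k} → Vec ℕ k → Set
  AllBoundary []       = ⊤
  AllBoundary (p ∷ ps) = Boundary p × AllBoundary ps

  atBoundary-clockTape : ∀ {p} → Boundary p → atBoundary (clockTape p) ≡ true
  atBoundary-clockTape (inj₁ refl) = refl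
  atBoundary-clockTape (inj₂ refl) rewrite ≥⇒<ᵇ≡false {m} {m} ≤-refl = refl

  allAtBoundary-clockTape : ∀ {k} (ps : Vec ℕ k) → AllBoundary ps → allAtBoundary (map clockTape ps) ≡ true
  allAtBoundary-clockTape []       _             = refl
  allAtBoundary-clockTape (p ∷ ps) (pB , psB) rewrite allAtBoundary-clockTape ps psB = atBoundary-clockTape pB

  bounces-suc : ∀ q h → bounces (suc q) h ≡ bounce₁ (bounces q h)
  bounces-suc zero    h = refl
  bounces-suc (suc q) h = bounces-suc q (bounce₁ h)

  bounces-rightward : ∀ q b → q ≤ m → bounces (suc q) (0 , b) ≡ (suc q , true)
  bounces-rightward zero    b _   = refl
  bounces-rightward (suc q) b q<m = begin
    bounces (suc (suc q)) (0 , b)   ≡⟨ bounces-suc (suc q) (0 , b) ⟩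
    bounce₁ (bounces (suc q) (0 , b)) ≡⟨ cong bounce₁ (bounces-rightward q b (<⇒≤ q<m)) ⟩
    bounce₁ (suc q , true)            ≡⟨ cong (λ z → move (bounce z true) (suc q) , bounceDir z true)
                                              (cong (λ z → if z then just mark else nothing) (<⇒<ᵇ≡true q<m)) ⟩
    (suc (suc q) , true)              ∎
    where open ≡-Reasoning

  bounces-leftward : ∀ q r b → r + q ≡ m → bounces (suc q) (suc m , b) ≡ (r , false)
  bounces-leftward zero r b r+0≡m rewrite +-identityʳ r | r+0≡m | ≥⇒<ᵇ≡false {m} {m} ≤-refl = refl
  bounces-leftward (suc q) r b r+q≡m = begin
    bounces (suc (suc q)) (suc m , b)   ≡⟨ bounces-suc (suc q) (suc m , b) ⟩
    bounce₁ (bounces (suc q) (suc m , b)) ≡⟨ cong bounce₁ (bounces-leftward q (suc r) b (trans (sym (+-suc r q)) r+q≡m)) ⟩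
    bounce₁ (suc r , false)               ≡⟨ cong (λ z → move (bounce z false) (suc r) , bounceDir z false)
                                                  (cong (λ z → if z then just mark else nothing) (<⇒<ᵇ≡true r<m)) ⟩
    (r , false)                           ∎
    where
    open ≡-Reasoning
    r<m : r < m
    r<m = subst (r <_) r+q≡m (m<m+n r {suc q} z<s)

  interior-clockTape : ∀ {q} → q < m → atBoundary (clockTape (suc q)) ≡ false
  interior-clockTape q<m rewrite <⇒<ᵇ≡true q<m = refl

  bounce-sweep : ∀ h → Boundary (proj₁ h) →
    (∀ q → 0 < q → q ≤ m → atBoundary (clockTape (proj₁ (bounces q h))) ≡ false) ×
    Boundary (proj₁ (bounces (suc m) h))
  bounce-sweep (0 , b) (inj₁ refl) = interior , inj₂ (cong proj₁ (bounces-rightward m b ≤-refl))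
    where
    interior : ∀ q → 0 < q → q ≤ m → atBoundary (clockTape (proj₁ (bounces q (0 , b)))) ≡ false
    interior (suc q) _ q<m rewrite bounces-rightward q b (<⇒≤ q<m) = interior-clockTape q<m
  bounce-sweep (suc m , b) (inj₂ refl) = interior , inj₁ (cong proj₁ (bounces-leftward m 0 b refl))
    where
    interior : ∀ q → 0 < q → q ≤ m → atBoundary (clockTape (proj₁ (bounces q (suc m , b)))) ≡ false
    interior (suc q) _ q<m
      rewrite bounces-leftward q (suc (m ∸ suc q)) b (trans (sym (+-suc (m ∸ suc q) q)) (m∸n+n≡m q<m)) =
      interior-clockTape (∸-monoʳ-< {m} {suc q} z<s q<m)

  period : ℕ → ℕ
  period k = suc m ^ k

  FirstReturnAtPeriod : ℕ → Set
  FirstReturnAtPeriod k = ∀ (u : Heads k) → AllBoundary (proj₁ u) →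
    (∀ t → 0 < t → t < period k → settled (ticks t u) ≡ false) × AllBoundary (proj₁ (ticks (period k) u))

  -- The new first head moves exactly when the other k heads are back at a boundary, i.e. once per
  -- period k, so it needs m + 1 of those periods to cross the block of m marks.
  module FirstReturnStep {k} (ih : FirstReturnAtPeriod k) where
    P = period k

    ticks-push-period : ∀ h (u : Heads k) → AllBoundary (proj₁ u) → ∀ r → 0 < r → r ≤ P →
                        ticks r (push h u) ≡ push (bounce₁ h) (ticks r u)
    ticks-push-period h u uB (suc r) _ r<P rewrite tick-push-settled h u (allAtBoundary-clockTape (proj₁ u) uB) =
      ticks-push-unsettled r (bounce₁ h) (tick u) (λ j j<r → proj₁ (ih u uB) (suc j) z<s (<-≤-trans (s<s j<r) r<P))

    instance
      P-nonZero : NonZero P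
      P-nonZero = m^n≢0 (suc m) k

    ticks-suc-* : ∀ {j} q (u : Heads j) → ticks (suc q * P) u ≡ ticks P (ticks (q * P) u)
    ticks-suc-* q u = trans (cong (λ z → ticks z u) (+-comm P (q * P))) (ticks-+ (q * P) P u)

    boundary-at-multiples : ∀ q (u : Heads k) → AllBoundary (proj₁ u) → AllBoundary (proj₁ (ticks (q * P) u))
    boundary-at-multiples zero    u uB = uB
    boundary-at-multiples (suc q) u uB rewrite ticks-suc-* q u = proj₂ (ih _ (boundary-at-multiples q u uB))

    ticks-push-multiple : ∀ q h (u : Heads k) → AllBoundary (proj₁ u) →
                          ticks (q * P) (push h u) ≡ push (bounces q h) (ticks (q * P) u)
    ticks-push-multiple zero    h u uB = refl
    ticks-push-multiple (suc q) h u uB = begin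
      ticks (suc q * P) (push h u)                            ≡⟨ ticks-suc-* q (push h u) ⟩
      ticks P (ticks (q * P) (push h u))                      ≡⟨ cong (ticks P) (ticks-push-multiple q h u uB) ⟩
      ticks P (push (bounces q h) (ticks (q * P) u))          ≡⟨ ticks-push-period _ _ (boundary-at-multiples q u uB)
                                                                   P (m^n>0 (suc m) k) ≤-refl ⟩
      push (bounce₁ (bounces q h)) (ticks P (ticks (q * P) u)) ≡⟨ cong₂ push (bounces-suc q h) (ticks-suc-* q u) ⟨
      push (bounces (suc q) h) (ticks (suc q * P) u)           ∎
      where open ≡-Reasoning

    unsettled-between : ∀ h (u : Heads k) → Boundary (proj₁ h) → AllBoundary (proj₁ u) →
                        ∀ q r → q ≤ m → r < P → 0 < q * P + r → settled (ticks (q * P + r) (push h u)) ≡ false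
    unsettled-between h u hB uB q r q≤m r<P 0<t
      rewrite ticks-+ (q * P) r (push h u) | ticks-push-multiple q h u uB = at-offset r r<P 0<t
      where
      w = ticks (q * P) u
      wB : AllBoundary (proj₁ w)
      wB = boundary-at-multiples q u uB
      at-offset : ∀ r → r < P → 0 < q * P + r → settled (ticks r (push (bounces q h) w)) ≡ false
      at-offset zero _ 0<qP+0 rewrite allAtBoundary-clockTape (proj₁ w) wB =
        proj₁ (bounce-sweep h hB) q 0<q q≤m
        where
        0<q : 0 < q
        0<q = >-nonZero⁻¹ q {{m*n≢0⇒m≢0 q {{>-nonZero (subst (0 <_) (+-identityʳ (q * P)) 0<qP+0)}}}}
      at-offset (suc r) r<P _ rewrite ticks-push-period (bounces q h) w wB (suc r) z<s (<⇒≤ r<P)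
                                    | proj₁ (ih w wB) (suc r) z<s r<P = refl

    firstReturnAtPeriod-suc : FirstReturnAtPeriod (suc k)
    firstReturnAtPeriod-suc (p ∷ ps , b ∷ ds) (pB , psB) = unsettled , settled-at-end
      where
      h = (p , b)
      u = (ps , ds)
      unsettled : ∀ t → 0 < t → t < period (suc k) → settled (ticks t (push h u)) ≡ false
      unsettled t 0<t t<period = subst (λ z → settled (ticks z (push h u)) ≡ false) (sym t≡)
        (unsettled-between h u pB psB (t / P) (t % P) (≤-pred (m<n*o⇒m/o<n t<period)) (m%n<n t P) (subst (0 <_) t≡ 0<t))
        where
        t≡ : t ≡ t / P * P + t % P
        t≡ = trans (m≡m%n+[m/n]*n t P) (+-comm (t % P) _)
      settled-at-end : AllBoundary (proj₁ (ticks (period (suc k)) (push h u)))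
      settled-at-end rewrite ticks-push-multiple (suc m) h u psB =
        proj₂ (bounce-sweep h pB) , boundary-at-multiples (suc m) u psB

  firstReturnAtPeriod : ∀ k → FirstReturnAtPeriod k
  firstReturnAtPeriod zero    ([] , []) _ = (λ { (suc t) _ (s≤s ()) }) , tt
  firstReturnAtPeriod (suc k) = FirstReturnStep.firstReturnAtPeriod-suc (firstReturnAtPeriod k)

#Dirs : ℕ → ℕ
#Dirs zero    = 1
#Dirs (suc k) = #Dirs k + #Dirs k

encodeDirs : ∀ {k} → Vec Bool k → Fin (#Dirs k)
encodeDirs []                     = Fin.zero
encodeDirs {suc k} (false ∷ ds) = encodeDirs ds Fin.↑ˡ #Dirs k
encodeDirs {suc k} (true  ∷ ds) = #Dirs k Fin.↑ʳ encodeDirs ds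

decodeDirs : ∀ {k} → Fin (#Dirs k) → Vec Bool k
decodeDirs {zero}  _ = []
decodeDirs {suc k} i with Fin.splitAt (#Dirs k) i
... | inj₁ j = false ∷ decodeDirs j
... | inj₂ j = true  ∷ decodeDirs j

decodeDirs-encodeDirs : ∀ {k} (ds : Vec Bool k) → decodeDirs (encodeDirs ds) ≡ ds
decodeDirs-encodeDirs [] = refl
decodeDirs-encodeDirs {suc k} (false ∷ ds) rewrite Finₚ.splitAt-↑ˡ (#Dirs k) (encodeDirs ds) (#Dirs k) =
  cong (false ∷_) (decodeDirs-encodeDirs ds)
decodeDirs-encodeDirs {suc k} (true ∷ ds) rewrite Finₚ.splitAt-↑ʳ (#Dirs k) (#Dirs k) (encodeDirs ds) =
  cong (true ∷_) (decodeDirs-encodeDirs ds)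

zipWith-move-mS : ∀ {n} (hs : Vec ℕ n) → zipWith move (replicate n mS) hs ≡ hs
zipWith-move-mS []       = refl
zipWith-move-mS (h ∷ hs) = cong (h ∷_) (zipWith-move-mS hs)

writeIndices-none : ∀ {n} (its : Vec (List (Maybe Bool)) n) ihs → writeIndices its ihs (replicate n nothing) ≡ its
writeIndices-none []         []       = refl
writeIndices-none (it ∷ its) (_ ∷ ihs) = cong (it ∷_) (writeIndices-none its ihs)

AllTapesAre : ∀ {γ k} → Tape γ → Vec (Tape γ) k → Set
AllTapesAre f []       = ⊤
AllTapesAre f (t ∷ ts) = (∀ q → t q ≡ f q) × AllTapesAre f ts

AllTapesAre-replicate : ∀ {γ} k (f : Tape γ) → AllTapesAre f (replicate k f)
AllTapesAre-replicate zero    f = tt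
AllTapesAre-replicate (suc k) f = (λ _ → refl) , AllTapesAre-replicate k f

scan-AllTapesAre : ∀ {γ k} {f : Tape γ} (ts : Vec (Tape γ) k) ps → AllTapesAre f ts → scan ts ps ≡ map f ps
scan-AllTapesAre []       []       _        = refl
scan-AllTapesAre (t ∷ ts) (p ∷ ps) (t≗f , all) = cong₂ _∷_ (t≗f p) (scan-AllTapesAre ts ps all)

scan-AllTapesAre-replicate : ∀ {γ k} {f : Tape γ} (ts : Vec (Tape γ) k) p → AllTapesAre f ts →
                             scan ts (replicate k p) ≡ replicate k (f p)
scan-AllTapesAre-replicate {k = k} {f} ts p all = trans (scan-AllTapesAre ts _ all) (map-replicate f p k)

overwrite-unchanged : ∀ {A : Set} (f : ℕ → Maybe A) {p a} → f p ≡ a →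
                      ∀ q → (if q ≡ᵇ p then a else f q) ≡ f q
overwrite-unchanged f {p} fp≡a q with q ≡ᵇ p in eq
... | true  rewrite ≡ᵇ⇒≡ q p (subst T (sym eq) tt) = sym fp≡a
... | false = refl

AllTapesAre-write : ∀ {γ k} {f g : Tape γ} (ts : Vec (Tape γ) k) p a → AllTapesAre f ts →
  (∀ q → (if q ≡ᵇ p then a else f q) ≡ g q) → AllTapesAre g (overwrite ts (replicate k p) (replicate k a))
AllTapesAre-write []       p a _             _     = tt
AllTapesAre-write (t ∷ ts) p a (t≗f , all) f→g = written , AllTapesAre-write ts p a all f→g
  where
  written : ∀ q → updateTape t p a q ≡ _
  written q with q ≡ᵇ p | f→g q
  ... | true  | eq = eq
  ... | false | eq = trans (t≗f q) eq

AllTapesAre-rewrite : ∀ {γ k} {f : Tape γ} (ts : Vec (Tape γ) k) hs → AllTapesAre f ts →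
                      AllTapesAre f (overwrite ts hs (map f hs))
AllTapesAre-rewrite []       []       _             = tt
AllTapesAre-rewrite {f = f} (t ∷ ts) (h ∷ hs) (t≗f , all) = rewritten , AllTapesAre-rewrite ts hs all
  where
  rewritten : ∀ q → updateTape t h (f h) q ≡ f q
  rewritten q with q ≡ᵇ h | overwrite-unchanged f {h} refl q
  ... | true  | eq = eq
  ... | false | _  = t≗f q

zeros : ℕ → List (Maybe Bool)
zeros zero    = []
zeros (suc r) = just false ∷ zeros r

pow2Bits : ℕ → List (Maybe Bool)
pow2Bits r = just true ∷ zeros r

zeros-snoc : ∀ r → writeAt (zeros r) r (just false) ≡ zeros (suc r)
zeros-snoc zero    = refl
zeros-snoc (suc r) = cong (just false ∷_) (zeros-snoc r)

pow2Bits-snoc : ∀ r → writeAt (pow2Bits r) (suc r) (just false) ≡ pow2Bits (suc r)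
pow2Bits-snoc r = cong (just true ∷_) (zeros-snoc r)

2^r*[2a+0]≡2^[1+r]*a : ∀ r a → 2 ^ r * (2 * a + 0) ≡ 2 ^ suc r * a
2^r*[2a+0]≡2^[1+r]*a r a = begin
  2 ^ r * (2 * a + 0)   ≡⟨ cong (2 ^ r *_) (+-identityʳ (2 * a)) ⟩
  2 ^ r * (2 * a)       ≡⟨ *-assoc (2 ^ r) 2 a ⟨
  2 ^ r * 2 * a         ≡⟨ cong (_* a) (*-comm (2 ^ r) 2) ⟩
  2 ^ suc r * a         ∎
  where open ≡-Reasoning

addrFrom-zeros : ∀ r a → addrFrom a (zeros r) ≡ 2 ^ r * a
addrFrom-zeros zero    a = sym (+-identityʳ a)
addrFrom-zeros (suc r) a = trans (addrFrom-zeros r (2 * a + 0)) (2^r*[2a+0]≡2^[1+r]*a r a)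

address-pow2Bits : ∀ r → address (pow2Bits r) ≡ 2 ^ r
address-pow2Bits r = trans (addrFrom-zeros r 1) (*-identityʳ (2 ^ r))

addrFrom-zeros-truncated : ∀ r a → addrFrom a (writeAt (zeros (suc r)) r nothing) ≡ 2 ^ r * a
addrFrom-zeros-truncated zero    a = sym (+-identityʳ a)
addrFrom-zeros-truncated (suc r) a = trans (addrFrom-zeros-truncated r (2 * a + 0)) (2^r*[2a+0]≡2^[1+r]*a r a)

address-pow2Bits-truncated : ∀ r → address (writeAt (pow2Bits (suc r)) (suc r) nothing) ≡ 2 ^ r
address-pow2Bits-truncated r = trans (addrFrom-zeros-truncated r 1) (*-identityʳ (2 ^ r))

cellAt-just : ∀ {A : Set} (x : List A) p → p < length x → ∃ λ v → cellAt x p ≡ just v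
cellAt-just (a ∷ x) zero    _         = a , refl
cellAt-just (a ∷ x) (suc p) (s≤s p<n) = cellAt-just x p p<n

cellAt-nothing : ∀ {A : Set} (x : List A) p → length x ≤ p → cellAt x p ≡ nothing
cellAt-nothing []      p       _         = refl
cellAt-nothing (a ∷ x) (suc p) (s≤s n≤p) = cellAt-nothing x p n≤p

doubling-fuel : ∀ {n} r k → n ≤ 2 ^ r + suc k → n ≤ 2 ^ suc r + k
doubling-fuel {n} r k n≤ = begin
  n                       ≤⟨ n≤ ⟩
  2 ^ r + suc k           ≤⟨ +-monoʳ-≤ (2 ^ r) (+-monoˡ-≤ k (≤-trans (m^n>0 2 r) (≤-reflexive (sym (+-identityʳ (2 ^ r)))))) ⟩
  2 ^ r + ((2 ^ r + 0) + k) ≡⟨ +-assoc (2 ^ r) (2 ^ r + 0) k ⟨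
  2 ^ suc r + k           ∎
  where open ≤-Reasoning

round-cost : ∀ r T R → T + (suc r + 2) * suc r ≤ (R + 2) * R → (suc (suc r) + T) + (r + 2) * r ≤ (R + 2) * R
round-cost r T R T≤ = begin
  (suc (suc r) + T) + (r + 2) * r ≡⟨ regroup r T ⟩
  T + (r + 2) * suc r             ≤⟨ +-monoʳ-≤ T (*-monoˡ-≤ (suc r) (n≤1+n (r + 2))) ⟩
  T + (suc r + 2) * suc r         ≤⟨ T≤ ⟩
  (R + 2) * R                     ∎
  where
  open ≤-Reasoning
  regroup : ∀ r T → (suc (suc r) + T) + (r + 2) * r ≡ T + (r + 2) * suc r
  regroup = solve-∀

-- R′ + 1 = max 1 ⌈log₂ n⌉
Brackets : ℕ → ℕ → Set
Brackets R′ n = n ≤ 2 ^ suc R′ × (R′ ≡ 0 ⊎ 2 ^ R′ < n)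

pattern bit0 = Fin.zero
pattern bit1 = Fin.suc Fin.zero

-- All suc w writable tapes always carry the same content.  Phase 1 lays down a block of r marks
-- while jumping the input head to 2 ^ r, r = 1, 2, …, until the jump lands beyond the input;
-- then it writes clockEnd, halves the input index and jumps back to 2 ^ (r ∸ 1).  Phase 2 runs
-- the odometer of the suc w heads over the block of marks and reads one input cell per tick:
-- a bit0 rejects, and the end of the input or the expiry of the clock accepts.
module Clocked (w : ℕ) where

  d : ℕ
  d = suc w

  data St : Set where
    start extend jump halve accept reject : St
    count : Vec Bool d → St

  nQ : ℕ
  nQ = 6 + #Dirs d

  encode : St → Fin nQ
  encode start      = Fin.zero
  encode extend     = Fin.suc Fin.zero
  encode jump       = Fin.suc (Fin.suc Fin.zero)
  encode halve      = Fin.suc (Fin.suc (Fin.suc Fin.zero))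
  encode accept     = Fin.suc (Fin.suc (Fin.suc (Fin.suc Fin.zero)))
  encode reject     = Fin.suc (Fin.suc (Fin.suc (Fin.suc (Fin.suc Fin.zero))))
  encode (count ds) = Fin.suc (Fin.suc (Fin.suc (Fin.suc (Fin.suc (Fin.suc (encodeDirs ds))))))

  decode : Fin nQ → St
  decode Fin.zero                                                      = start
  decode (Fin.suc Fin.zero)                                            = extend
  decode (Fin.suc (Fin.suc Fin.zero))                                  = jump
  decode (Fin.suc (Fin.suc (Fin.suc Fin.zero)))                        = halve
  decode (Fin.suc (Fin.suc (Fin.suc (Fin.suc Fin.zero))))              = accept
  decode (Fin.suc (Fin.suc (Fin.suc (Fin.suc (Fin.suc Fin.zero)))))    = reject
  decode (Fin.suc (Fin.suc (Fin.suc (Fin.suc (Fin.suc (Fin.suc i)))))) = count (decodeDirs i)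

  decode-encode : ∀ st → decode (encode st) ≡ st
  decode-encode start      = refl
  decode-encode extend     = refl
  decode-encode jump       = refl
  decode-encode halve      = refl
  decode-encode accept     = refl
  decode-encode reject     = refl
  decode-encode (count ds) = cong count (decodeDirs-encodeDirs ds)

  Act : Set
  Act = Action nQ 3 w

  goto : St → Vec (Maybe Sym) d → Vec Move (suc d) → Vec (Maybe (Maybe Bool)) (suc d) → Vec Move (suc d) → Act
  goto st ws mv iw im = record { next = encode st ; writes = ws ; moves = mv ; iwrite = iw ; imoves = im }

  noIndexWrites : Vec (Maybe (Maybe Bool)) (suc d)
  noIndexWrites = replicate _ nothing

  stay : Vec Move (suc d)
  stay = replicate _ mS

  halt-with : St → Vec (Maybe Sym) d → Act
  halt-with st rs = goto st rs stay noIndexWrites stay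

  tickAct : Vec Bool d → Maybe (Fin 2) → Vec (Maybe Sym) d → Act
  tickAct ds (just bit0) rs = halt-with reject rs
  tickAct ds nothing     rs = halt-with accept rs
  tickAct ds (just bit1) rs = goto (count (odometerDirs rs ds)) rs (mR ∷ odometerMoves rs ds) noIndexWrites stay

  extendAct : Maybe Sym → Vec (Maybe Sym) d → Act
  extendAct nothing  rs = goto jump (replicate _ (just mark)) stay
                                (just (just false) ∷ replicate _ nothing) (mR ∷ replicate _ mS)
  extendAct (just _) rs = goto extend rs (mS ∷ replicate _ mR) noIndexWrites stay

  jumpAct : Maybe Sym → Maybe (Fin 2) → Vec (Maybe Sym) d → Act
  jumpAct (just searchEnd) nothing  rs = goto halve (replicate _ (just clockEnd)) stay noIndexWrites (mL ∷ replicate _ mS)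
  jumpAct (just searchEnd) (just _) rs = goto extend rs (mS ∷ replicate _ mR) noIndexWrites stay
  jumpAct _                inp      rs = tickAct (replicate _ true) inp rs

  countAct : Bool → Vec Bool d → Maybe (Fin 2) → Vec (Maybe Sym) d → Act
  countAct true  ds inp rs = halt-with accept rs
  countAct false ds inp rs = tickAct ds inp rs

  transition : St → Maybe (Fin 2) → Vec (Maybe Sym) d → Act
  transition start      inp rs = goto extend (replicate _ (just searchEnd)) (mS ∷ replicate _ mR)
                                      (just (just true) ∷ replicate _ nothing) (mR ∷ replicate _ mS)
  transition extend     inp rs = extendAct (head rs) rs
  transition jump       inp rs = jumpAct (head rs) inp rs
  transition halve      inp rs = goto jump rs stay (just nothing ∷ replicate _ nothing) stay
  transition (count ds) inp rs = countAct (allAtBoundary rs) ds inp rs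
  transition accept     inp rs = halt-with accept rs
  transition reject     inp rs = halt-with reject rs

  answer : St → Maybe Bool
  answer accept = just true
  answer reject = just false
  answer _      = nothing

  machine : RATM 2
  machine = record
    { w = w ; nQ = nQ ; γ = 3 ; start = encode start ; qa = encode jump
    ; halt = λ q → answer (decode q)
    ; δ = λ q inp rs → transition (decode q) inp rs }

  open Run machine
  open RunProperties machine
  open Config

  searchTape : ℕ → Tape 3
  searchTape r zero    = just searchEnd
  searchTape r (suc q) = Clock.clockTape r (suc q)

  indexTapes : ℕ → Vec (List (Maybe Bool)) (suc d)
  indexTapes r = pow2Bits r ∷ replicate _ []

  indexHeads : ℕ → Vec ℕ (suc d)
  indexHeads ih = ih ∷ replicate _ 0

  At : St → ℕ → Vec ℕ d → Tape 3 → Config → Set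
  At st i hs f c = state c ≡ encode st × ihead c ≡ i × heads c ≡ hs × AllTapesAre f (tapes c)

  At⁺ : St → ℕ → Vec ℕ d → Tape 3 → ℕ → ℕ → Config → Set
  At⁺ st i hs f r ih c = At st i hs f c × itapes c ≡ indexTapes r × iheads c ≡ indexHeads ih

  Round : ℕ → Config → Set
  Round r = At⁺ jump (2 ^ r) (replicate d 0) (searchTape r) r (suc r)

  Extending : ℕ → ℕ → ℕ → Config → Set
  Extending i r j = At⁺ extend i (replicate d (suc j)) (searchTape r) r (suc r)

  Ready : ℕ → ℕ → Config → Set
  Ready m base = At jump base (replicate d 0) (Clock.clockTape m)

  step-at : ∀ x c st v rs → state c ≡ encode st → answer st ≡ nothing →
            cellAt x (ihead c) ≡ v → scanned c ≡ rs → step x c ≡ perform c (transition st v rs)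
  step-at x c st v rs c-st running c-v c-rs = begin
    step x c
      ≡⟨ step-running x c halt≡nothing ⟩
    perform c (transition (decode (state c)) (cellAt x (ihead c)) (scanned c))
      ≡⟨ cong₂ (λ v′ rs′ → perform c (transition (decode (state c)) v′ rs′)) c-v c-rs ⟩
    perform c (transition (decode (state c)) v rs)
      ≡⟨ cong (λ st′ → perform c (transition st′ v rs)) decode-st ⟩
    perform c (transition st v rs)
      ∎
    where
    open ≡-Reasoning
    decode-st : decode (state c) ≡ st
    decode-st = trans (cong decode c-st) (decode-encode st)
    halt≡nothing : answer (decode (state c)) ≡ nothing
    halt≡nothing = trans (cong answer decode-st) running

  start-step : ∀ x → Extending 0 0 0 (step x (init x))
  start-step x = subst (Extending 0 0 0) (sym (step-at x (init x) start _ _ refl refl refl refl))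
    ((refl , refl , zipWith-replicate move mR 0 ,
      AllTapesAre-write (replicate d (λ _ → nothing)) 0 (just searchEnd) (AllTapesAre-replicate d _) written) ,
     cong (pow2Bits 0 ∷_) (writeIndices-none {d} (replicate d []) (replicate d 0)) , cong (1 ∷_) (zipWith-move-mS _))
    where
    written : ∀ q → (if q ≡ᵇ 0 then just searchEnd else nothing) ≡ searchTape 0 q
    written zero    = refl
    written (suc q) = refl

  extend-step : ∀ x c r p i → p < r → Extending i r p c → Extending i r (suc p) (step x c)
  extend-step x record { tapes = ts } r p i p<r ((refl , refl , refl , all) , refl , refl) =
    subst (Extending i r (suc p)) (sym (step-at x _ extend _ _ refl refl refl scanned-mark))
      ((refl , refl , zipWith-replicate move mR (suc p) ,
        AllTapesAre-write ts (suc p) (just mark) all (overwrite-unchanged (searchTape r) marked)) ,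
       writeIndices-none (indexTapes r) (indexHeads (suc r)) , zipWith-move-mS _)
    where
    marked : searchTape r (suc p) ≡ just mark
    marked rewrite <⇒<ᵇ≡true p<r = refl
    scanned-mark : scan ts (replicate d (suc p)) ≡ replicate d (just mark)
    scanned-mark = trans (scan-AllTapesAre-replicate ts (suc p) all) (cong (replicate d) marked)

  searchTape-extended : ∀ r q → (if q ≡ᵇ suc r then just mark else searchTape r q) ≡ searchTape (suc r) q
  searchTape-extended r zero = refl
  searchTape-extended r (suc q) with q ≡ᵇ r in eq
  ... | true  rewrite ≡ᵇ⇒≡ q r (subst T (sym eq) tt) | <⇒<ᵇ≡true (n<1+n r) = refl
  ... | false rewrite <ᵇ-suc q r eq = refl

  extend-done : ∀ x c r i → Extending i r r c → Round (suc r) (step x c)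
  extend-done x record { tapes = ts } r i ((refl , refl , refl , all) , refl , refl) =
    subst (Round (suc r)) (sym (step-at x _ extend _ _ refl refl refl scanned-blank))
      ((refl , trans (cong address (pow2Bits-snoc r)) (address-pow2Bits (suc r)) ,
        trans (cong (map address) (writeIndices-none {d} (replicate d []) (replicate d 0))) (map-replicate address [] d) ,
        AllTapesAre-write ts (suc r) (just mark) all (searchTape-extended r)) ,
       cong₂ _∷_ (pow2Bits-snoc r) (writeIndices-none {d} (replicate d []) (replicate d 0)) ,
       cong (suc (suc r) ∷_) (zipWith-move-mS _))
    where
    blank : searchTape r (suc r) ≡ nothing
    blank rewrite ≥⇒<ᵇ≡false {r} {r} ≤-refl = refl
    scanned-blank : scan ts (replicate d (suc r)) ≡ replicate d nothing
    scanned-blank = trans (scan-AllTapesAre-replicate ts (suc r) all) (cong (replicate d) blank)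

  jump-inside : ∀ x c r {v} → cellAt x (2 ^ r) ≡ just v → Round r c → Extending (2 ^ r) r 0 (step x c)
  jump-inside x record { tapes = ts } r read ((refl , refl , refl , all) , refl , refl) =
    subst (Extending (2 ^ r) r 0)
      (sym (step-at x _ jump _ _ refl refl read (scan-AllTapesAre-replicate ts 0 all)))
      ((refl , refl , zipWith-replicate move mR 0 ,
        AllTapesAre-write ts 0 (just searchEnd) all (overwrite-unchanged (searchTape r) refl)) ,
       writeIndices-none (indexTapes r) (indexHeads (suc r)) , zipWith-move-mS _)

  jump-outside : ∀ x c r → cellAt x (2 ^ r) ≡ nothing → Round r c →
                 At⁺ halve (2 ^ r) (replicate d 0) (Clock.clockTape r) r r (step x c)
  jump-outside x record { tapes = ts } r read ((refl , refl , refl , all) , refl , refl) =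
    subst (At⁺ halve (2 ^ r) (replicate d 0) (Clock.clockTape r) r r)
      (sym (step-at x _ jump _ _ refl refl read (scan-AllTapesAre-replicate ts 0 all)))
      ((refl , refl , zipWith-move-mS _ , AllTapesAre-write ts 0 (just clockEnd) all written) ,
       writeIndices-none (indexTapes r) (indexHeads (suc r)) , cong (r ∷_) (zipWith-move-mS _))
    where
    written : ∀ q → (if q ≡ᵇ 0 then just clockEnd else searchTape r q) ≡ Clock.clockTape r q
    written zero    = refl
    written (suc q) = refl

  halve-step : ∀ x c r i → At⁺ halve i (replicate d 0) (Clock.clockTape (suc r)) (suc r) (suc r) c →
               Ready (suc r) (2 ^ r) (step x c)
  halve-step x c@record { tapes = ts } r i ((refl , refl , refl , all) , refl , refl) =
    subst (Ready (suc r) (2 ^ r))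
      (sym (step-at x c halve _ _ refl refl refl (scan-AllTapesAre-replicate ts 0 all)))
      (refl , address-pow2Bits-truncated r ,
       trans (cong (map address) (writeIndices-none {d} (replicate d []) (replicate d 0))) (map-replicate address [] d) ,
       AllTapesAre-write ts 0 (just clockEnd) all (overwrite-unchanged (Clock.clockTape (suc r)) refl))

  extend-steps : ∀ x c r i j → j ≤ r → Extending i r 0 c → Extending i r j (run x j c)
  extend-steps x c r i zero    _   at = at
  extend-steps x c r i (suc j) j<r at = subst (Extending i r (suc j))
    (sym (run-suc x j c)) (extend-step x (run x j c) r j i j<r (extend-steps x c r i j (<⇒≤ j<r) at))

  doubling-round : ∀ x c r {v} → cellAt x (2 ^ r) ≡ just v → Round r c → Round (suc r) (run x (suc (suc r)) c)
  doubling-round x c r read at =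
    subst (Round (suc r)) (sym (run-suc x r (step x c)))
      (extend-done x _ r (2 ^ r) (extend-steps x (step x c) r (2 ^ r) r ≤-refl (jump-inside x c r read at)))

  Search : List (Fin 2) → ℕ → Config → Set
  Search x r c = Σ ℕ λ R → Σ ℕ λ T → Round R (run x T c) ×
    length x ≤ 2 ^ R × (R ≡ r ⊎ 2 ^ pred R < length x) × r ≤ R × T + (r + 2) * r ≤ (R + 2) * R

  -- n ≤ 2 ^ r + fuel guarantees that the doubling terminates within fuel rounds.
  search : ∀ x fuel r c → length x ≤ 2 ^ r + fuel → Round r c → Search x r c
  search x fuel r c n≤ at with 2 ^ r <? length x
  ... | no 2^r≮n = r , 0 , at , ≮⇒≥ 2^r≮n , inj₁ refl , ≤-refl , ≤-refl
  search x zero r c n≤ at | yes 2^r<n = ⊥-elim (<⇒≱ 2^r<n (≤-trans n≤ (≤-reflexive (+-identityʳ _))))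
  search x (suc fuel) r c n≤ at | yes 2^r<n with cellAt-just x (2 ^ r) 2^r<n
  ... | _ , read with search x fuel (suc r) (run x (suc (suc r)) c) (doubling-fuel r fuel n≤) (doubling-round x c r read at)
  ... | R , T , at′ , n≤2^R , R≡ , r<R , T≤ =
    R , suc (suc r) + T , subst (Round R) (sym (run-+ x (suc (suc r)) T c)) at′ ,
    n≤2^R , inj₂ (passed R≡) , <⇒≤ r<R , round-cost r T R T≤
    where
    passed : R ≡ suc r ⊎ 2 ^ pred R < length x → 2 ^ pred R < length x
    passed (inj₁ refl) = 2^r<n
    passed (inj₂ lt)   = lt

  Phase₁ : List (Fin 2) → Set
  Phase₁ x = Σ ℕ λ R′ → Σ ℕ λ T₁ →
    Ready (suc R′) (2 ^ R′) (run x T₁ (init x)) ×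
    Brackets R′ (length x) × T₁ ≤ 4 + (suc R′ + 2) * suc R′

  phase₁ : ∀ x → Phase₁ x
  phase₁ x with search x (length x) 1 c₂ (m≤n+m (length x) 2) (extend-done x (step x (init x)) 0 0 (start-step x))
    where c₂ = run x 2 (init x)
  ... | suc R′ , T , at , n≤ , R≡ , _ , T≤ =
    R′ , 2 + (T + 2) ,
    subst (Ready (suc R′) (2 ^ R′))
      (sym (trans (run-+ x 2 (T + 2) (init x)) (run-+ x T 2 c₂)))
      (halve-step x _ R′ (2 ^ suc R′) (jump-outside x (run x T c₂) (suc R′) (cellAt-nothing x (2 ^ suc R′) n≤) at)) ,
    (n≤ , below R≡) , cost
    where
    c₂ = run x 2 (init x)
    below : suc R′ ≡ 1 ⊎ 2 ^ R′ < length x → R′ ≡ 0 ⊎ 2 ^ R′ < length x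
    below (inj₁ refl) = inj₁ refl
    below (inj₂ lt)   = inj₂ lt
    cost : 2 + (T + 2) ≤ 4 + (suc R′ + 2) * suc R′
    cost = ≤-trans (≤-reflexive (trans (cong (2 +_) (+-comm T 2)) (sym (+-assoc 2 2 T))))
                   (+-monoʳ-≤ 4 (≤-trans (m≤m+n T _) T≤))

  Halted : Config → Set
  Halted c = Σ Bool λ b → verdict c ≡ just b

  module Phase₂ (m : ℕ) where
    open Clock m

    Counting : ℕ → Heads d → Config → Set
    Counting i u = At (count (proj₂ u)) i (proj₁ u) clockTape

    count-reads : ∀ x c i u {v} → settled u ≡ false → cellAt x i ≡ v → Counting i u c →
                  step x c ≡ perform c (tickAct (proj₂ u) v (map clockTape (proj₁ u)))
    count-reads x c@record { tapes = ts } i (ps , ds) unsettled read (refl , refl , refl , all) =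
      trans (step-at x c (count ds) _ _ refl refl read (scan-AllTapesAre ts ps all))
        (cong (λ b → perform c (countAct b ds _ (map clockTape ps))) unsettled)

    jump-reads : ∀ x c i {v} → cellAt x i ≡ v → Ready m i c →
                 step x c ≡ perform c (tickAct (replicate d true) v (map clockTape (replicate d 0)))
    jump-reads x c@record { tapes = ts } i read (refl , refl , refl , all) =
      step-at x c jump _ _ refl refl read (scan-AllTapesAre ts (replicate d 0) all)

    count-on-bit1 : ∀ x c i u → settled u ≡ false → cellAt x i ≡ just bit1 → Counting i u c →
                 Counting (suc i) (tick u) (step x c)
    count-on-bit1 x c@record { tapes = ts } i (ps , ds) unsettled read (refl , refl , refl , all) =
      subst (Counting (suc i) (tick (ps , ds))) (sym (count-reads x c i (ps , ds) unsettled read (refl , refl , refl , all)))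
        (refl , refl , refl , AllTapesAre-rewrite ts ps all)

    start₀ : Heads d
    start₀ = replicate d 0 , replicate d true

    begin-on-bit1 : ∀ x c i → cellAt x i ≡ just bit1 → Ready m i c → Counting (suc i) (tick start₀) (step x c)
    begin-on-bit1 x c@record { tapes = ts } i read (refl , refl , refl , all) =
      subst (Counting (suc i) (tick start₀)) (sym (jump-reads x c i read (refl , refl , refl , all)))
        (refl , refl , refl , AllTapesAre-rewrite ts (replicate d 0) all)

    count-expired : ∀ x c i u → settled u ≡ true → Counting i u c → verdict (step x c) ≡ just true
    count-expired x c@record { tapes = ts } i (ps , ds) expired (refl , refl , refl , all) =
      cong verdict (trans (step-at x c (count ds) _ _ refl refl refl (scan-AllTapesAre ts ps all))
        (cong (λ b → perform c (countAct b ds (cellAt x i) (map clockTape ps))) expired))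

    P : ℕ
    P = period d

    CountingFor : ℕ → ℕ → Config → Set
    CountingFor base t = Counting (t + base) (ticks t start₀)

    AllBoundary-zeros : ∀ k → AllBoundary (replicate k 0)
    AllBoundary-zeros zero    = tt
    AllBoundary-zeros (suc k) = inj₁ refl , AllBoundary-zeros k

    unsettled : ∀ t → 0 < t → t < P → settled (ticks t start₀) ≡ false
    unsettled = proj₁ (firstReturnAtPeriod d start₀ (AllBoundary-zeros d))

    expired : settled (ticks P start₀) ≡ true
    expired = allAtBoundary-clockTape _ (proj₂ (firstReturnAtPeriod d start₀ (AllBoundary-zeros d)))

    counting-step : ∀ x base t c → 0 < t → t < P → cellAt x (t + base) ≡ just bit1 →
                    CountingFor base t c → CountingFor base (suc t) (step x c)
    counting-step x base t c 0<t t<P read counting =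
      subst (λ u → Counting (suc t + base) u (step x c)) (sym (ticks-suc t start₀))
        (count-on-bit1 x c (t + base) (ticks t start₀) (unsettled t 0<t t<P) read counting)

    counting-run : ∀ x c₀ base → Ready m base c₀ → ∀ t → 0 < t → t ≤ P →
                   (∀ j → j < t → cellAt x (j + base) ≡ just bit1) → CountingFor base t (run x t c₀)
    counting-run x c₀ base at (suc zero) _ _ ones = begin-on-bit1 x c₀ base (ones 0 z<s) at
    counting-run x c₀ base at (suc (suc t)) _ t<P ones =
      subst (CountingFor base (suc (suc t))) (sym (run-suc x (suc t) c₀))
        (counting-step x base (suc t) (run x (suc t) c₀) z<s t<P (ones (suc t) ≤-refl)
          (counting-run x c₀ base at (suc t) z<s (<⇒≤ t<P) (λ j j<t → ones j (<-trans j<t ≤-refl))))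

    halted-step : ∀ x c → Halted c → Halted (step x c)
    halted-step x c (b , halted) = b , trans (cong verdict (step-halted x c halted)) halted

    halted-run-suc : ∀ x t c₀ → Halted (step x (run x t c₀)) → Halted (run x (suc t) c₀)
    halted-run-suc x t c₀ = subst Halted (sym (run-suc x t c₀))

    begin-or-halt : ∀ x c base → Ready m base c → Halted (step x c) ⊎ CountingFor base 1 (step x c)
    begin-or-halt x c base ready with cellAt x base in read
    ... | just bit1 = inj₂ (begin-on-bit1 x c base read ready)
    ... | just bit0 = inj₁ (false , cong verdict (jump-reads x c base read ready))
    ... | nothing   = inj₁ (true , cong verdict (jump-reads x c base read ready))

    tick-or-halt : ∀ x base t c → 0 < t → t < P → CountingFor base t c →
                   Halted (step x c) ⊎ CountingFor base (suc t) (step x c)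
    tick-or-halt x base t c 0<t t<P counting with cellAt x (t + base) in read
    ... | just bit1 = inj₂ (counting-step x base t c 0<t t<P read counting)
    ... | just bit0 = inj₁ (false , cong verdict
                        (count-reads x c (t + base) (ticks t start₀) (unsettled t 0<t t<P) read counting))
    ... | nothing   = inj₁ (true , cong verdict
                        (count-reads x c (t + base) (ticks t start₀) (unsettled t 0<t t<P) read counting))

    counting-or-halted : ∀ x c₀ base → Ready m base c₀ → ∀ t → 0 < t → t ≤ P →
                         Halted (run x t c₀) ⊎ CountingFor base t (run x t c₀)
    counting-or-halted x c₀ base ready (suc zero)    _ _   = begin-or-halt x c₀ base ready
    counting-or-halted x c₀ base ready (suc (suc t)) _ t<P =
      subst (λ c → Halted c ⊎ CountingFor base (suc (suc t)) c) (sym (run-suc x (suc t) c₀))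
        (next (counting-or-halted x c₀ base ready (suc t) z<s (<⇒≤ t<P)))
      where
      c = run x (suc t) c₀
      next : Halted c ⊎ CountingFor base (suc t) c → Halted (step x c) ⊎ CountingFor base (suc (suc t)) (step x c)
      next (inj₁ halted)   = inj₁ (halted-step x c halted)
      next (inj₂ counting) = tick-or-halt x base (suc t) c z<s t<P counting

    phase₂-halts : ∀ x c₀ base → Ready m base c₀ → Halted (run x (suc P) c₀)
    phase₂-halts x c₀ base ready =
      halted-run-suc x P c₀ (last-step (counting-or-halted x c₀ base ready P (m^n>0 (suc m) d) ≤-refl))
      where
      last-step : Halted (run x P c₀) ⊎ CountingFor base P (run x P c₀) → Halted (step x (run x P c₀))
      last-step (inj₁ halted)   = halted-step x _ halted
      last-step (inj₂ counting) = true , count-expired x (run x P c₀) (P + base) (ticks P start₀) expired counting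

    phase₂-accepts : ∀ x c₀ base → Ready m base c₀ →
                     (∀ j → j < P → cellAt x (j + base) ≡ just bit1) → verdict (run x (suc P) c₀) ≡ just true
    phase₂-accepts x c₀ base at ones = trans (cong verdict (run-suc x P c₀))
      (count-expired x (run x P c₀) (P + base) (ticks P start₀) expired
        (counting-run x c₀ base at P (m^n>0 (suc m) d) ≤-refl ones))

    phase₂-rejects : ∀ x c₀ base t → Ready m base c₀ → t < P →
                     (∀ j → j < t → cellAt x (j + base) ≡ just bit1) → cellAt x (t + base) ≡ just bit0 →
                     verdict (run x (suc t) c₀) ≡ just false
    phase₂-rejects x c₀ base zero    at _   _    read = cong verdict (jump-reads x c₀ base read at)
    phase₂-rejects x c₀ base (suc t) at t<P ones read = trans (cong verdict (run-suc x (suc t) c₀))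
      (cong verdict (count-reads x (run x (suc t) c₀) (suc t + base) (ticks (suc t) start₀) (unsettled (suc t) z<s t<P) read
        (counting-run x c₀ base at (suc t) z<s (<⇒≤ t<P) ones)))

n<2^n : ∀ n → n < 2 ^ n
n<2^n zero    = z<s
n<2^n (suc n) = begin-strict
  suc n           <⟨ s<s (n<2^n n) ⟩
  suc (2 ^ n)     ≡⟨ +-comm 1 (2 ^ n) ⟩
  2 ^ n + 1       ≤⟨ +-monoʳ-≤ (2 ^ n) (≤-trans (m^n>0 2 n) (≤-reflexive (sym (+-identityʳ (2 ^ n))))) ⟩
  2 ^ n + (2 ^ n + 0) ≡⟨⟩
  2 ^ suc n       ∎
  where open ≤-Reasoning

^-cancelʳ-< : ∀ {a b} → 2 ^ a < 2 ^ b → a < b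
^-cancelʳ-< 2^a<2^b = ≰⇒> (λ b≤a → <⇒≱ 2^a<2^b (^-monoʳ-≤ 2 b≤a))

^-cancelʳ-≤ : ∀ {a b} → 2 ^ a ≤ 2 ^ b → a ≤ b
^-cancelʳ-≤ 2^a≤2^b = ≮⇒≥ (λ b<a → <⇒≱ (^-monoʳ-< 2 (s≤s (s≤s z≤n)) b<a) 2^a≤2^b)

^-distribʳ-* : ∀ a b d → (a * b) ^ d ≡ a ^ d * b ^ d
^-distribʳ-* a b zero    = refl
^-distribʳ-* a b (suc d) = trans (cong (a * b *_) (^-distribʳ-* a b d)) (interchange a b (a ^ d) (b ^ d))
  where
  interchange : ∀ a b x y → a * b * (x * y) ≡ (a * x) * (b * y)
  interchange = solve-∀

-- With k = 2 ^ (j + j) = (2 ^ j) ^ 2: 2 + k ≤ 2 ^ (1 + j + j), and (1 + j + j) d ≤ (1 + j) ^ 2 ≤ k.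
[2+k]^d≤2^k : ∀ d j → 1 ≤ j → d + d ≤ j → (2 + 2 ^ (j + j)) ^ d ≤ 2 ^ (2 ^ (j + j))
[2+k]^d≤2^k d j 1≤j 2d≤j = begin
  (2 + k) ^ d            ≤⟨ ^-monoˡ-≤ d 2+k≤ ⟩
  (2 ^ suc (j + j)) ^ d  ≡⟨ ^-*-assoc 2 (suc (j + j)) d ⟩
  2 ^ (suc (j + j) * d)  ≤⟨ ^-monoʳ-≤ 2 exponent≤ ⟩
  2 ^ k                  ∎
  where
  open ≤-Reasoning
  k = 2 ^ (j + j)
  A = 2 ^ j
  k≡A*A : k ≡ A * A
  k≡A*A = ^-distribˡ-+-* 2 j j
  2≤k : 2 ≤ k
  2≤k = ^-monoʳ-≤ 2 (≤-trans 1≤j (m≤m+n j j))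
  2+k≤ : 2 + k ≤ 2 ^ suc (j + j)
  2+k≤ = ≤-trans (+-monoˡ-≤ k 2≤k) (≤-reflexive (cong (k +_) (sym (+-identityʳ k))))
  regroup₁ : ∀ j d → suc (j + j) * d ≡ j * (d + d) + d
  regroup₁ = solve-∀
  regroup₂ : ∀ j → suc j * suc j ≡ j * j + (j + suc j)
  regroup₂ = solve-∀
  exponent≤ : suc (j + j) * d ≤ k
  exponent≤ = begin
    suc (j + j) * d        ≡⟨ regroup₁ j d ⟩
    j * (d + d) + d        ≤⟨ +-mono-≤ (*-monoʳ-≤ j 2d≤j) (≤-trans (≤-trans (m≤m+n d d) 2d≤j) (m≤m+n j (suc j))) ⟩
    j * j + (j + suc j)    ≡⟨ regroup₂ j ⟨
    suc j * suc j          ≤⟨ *-mono-≤ (n<2^n j) (n<2^n j) ⟩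
    A * A                  ≡⟨ k≡A*A ⟨
    k                      ∎

large-scale : ∀ d c N → Σ ℕ λ k → c < suc k × N ≤ 2 ^ suc k × (2 + k) ^ d ≤ 2 ^ k
large-scale d c N = k , s≤s (<⇒≤ (≤-<-trans c≤j j<k)) , N≤ , [2+k]^d≤2^k d j (m≤n+m 1 _) 2d≤j
  where
  j = (d + d) + c + N + 1
  k = 2 ^ (j + j)
  j<k : j < k
  j<k = <-≤-trans (n<2^n j) (^-monoʳ-≤ 2 (m≤m+n j j))
  c≤j : c ≤ j
  c≤j = ≤-trans (m≤n+m c (d + d)) (≤-trans (m≤m+n _ N) (m≤m+n _ 1))
  2d≤j : d + d ≤ j
  2d≤j = ≤-trans (m≤m+n (d + d) c) (≤-trans (m≤m+n _ N) (m≤m+n _ 1))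
  N≤ : N ≤ 2 ^ suc k
  N≤ = ≤-trans (<⇒≤ (n<2^n N)) (^-monoʳ-≤ 2 (≤-trans (≤-trans (m≤n+m N _) (m≤m+n _ 1)) (≤-trans (<⇒≤ j<k) (n≤1+n k))))

m+n≤[1+m]*n : ∀ m {n} → 1 ≤ n → m + n ≤ suc m * n
m+n≤[1+m]*n m {n} 1≤n = subst (m + n ≤_) (+-comm (m * n) n) (+-monoˡ-≤ n (m≤m*n m n {{>-nonZero 1≤n}}))

polylog-bound : ∀ d L → 1 ≤ L → 2 ≤ d → 5 + (suc L + 2) * suc L + suc (suc L) ^ d ≤ (13 + 3 ^ d) * L ^ d
polylog-bound d L 1≤L 2≤d = begin
  5 + (suc L + 2) * suc L + suc (suc L) ^ d        ≤⟨ +-mono-≤ (+-mono-≤ (*-monoʳ-≤ 5 1≤L^d) (*-mono-≤ 3+L≤4L 1+L≤2L))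
                                                                (^-monoˡ-≤ d 2+L≤3L) ⟩
  5 * L ^ d + 4 * L * (2 * L) + (3 * L) ^ d        ≡⟨ cong₂ (λ a b → 5 * L ^ d + a + b) (regroup₁ L) (^-distribʳ-* 3 L d) ⟩
  5 * L ^ d + 8 * (L * L) + 3 ^ d * L ^ d          ≤⟨ +-monoˡ-≤ _ (+-monoʳ-≤ (5 * L ^ d) (*-monoʳ-≤ 8 L*L≤L^d)) ⟩
  5 * L ^ d + 8 * L ^ d + 3 ^ d * L ^ d            ≡⟨ regroup₂ (L ^ d) (3 ^ d) ⟩
  (13 + 3 ^ d) * L ^ d                             ∎
  where
  open ≤-Reasoning
  instance
    L-nonZero : NonZero L
    L-nonZero = >-nonZero 1≤L
  1≤L^d : 1 ≤ L ^ d
  1≤L^d = m^n>0 L d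
  L*L≤L^d : L * L ≤ L ^ d
  L*L≤L^d = ≤-trans (≤-reflexive (cong (L *_) (sym (*-identityʳ L)))) (^-monoʳ-≤ L 2≤d)
  3+L≤4L : suc L + 2 ≤ 4 * L
  3+L≤4L = subst (_≤ 4 * L) (trans (+-comm 3 L) (+-suc L 2)) (m+n≤[1+m]*n 3 1≤L)
  1+L≤2L : suc L ≤ 2 * L
  1+L≤2L = m+n≤[1+m]*n 1 1≤L
  2+L≤3L : suc (suc L) ≤ 3 * L
  2+L≤3L = m+n≤[1+m]*n 2 1≤L
  regroup₁ : ∀ L → 4 * L * (2 * L) ≡ 8 * (L * L)
  regroup₁ = solve-∀
  regroup₂ : ∀ x y → 5 * x + 8 * x + y * x ≡ (13 + y) * x
  regroup₂ = solve-∀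

Brackets⇒≤⌊log₂⌋ : ∀ {R′ n} → Brackets R′ n → R′ ≤ ⌊log₂ n ⌋
Brackets⇒≤⌊log₂⌋ (_ , inj₁ refl) = z≤n
Brackets⇒≤⌊log₂⌋ {R′} (_ , inj₂ 2^R′<n) = subst (_≤ _) (⌊log₂[2^n]⌋≡n R′) (⌊log₂⌋-mono-≤ (<⇒≤ 2^R′<n))

Brackets-2^ : ∀ {R′ k} → Brackets R′ (2 ^ suc k) → R′ ≡ k
Brackets-2^ {R′} {k} (n≤ , below) = ≤-antisym (R′≤k below) (≤-pred (^-cancelʳ-≤ n≤))
  where
  R′≤k : R′ ≡ 0 ⊎ 2 ^ R′ < 2 ^ suc k → R′ ≤ k
  R′≤k (inj₁ refl) = z≤n
  R′≤k (inj₂ lt)   = ≤-pred (^-cancelʳ-< lt)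

+2^k<2^[1+k] : ∀ {j} k → j < 2 ^ k → j + 2 ^ k < 2 ^ suc k
+2^k<2^[1+k] {j} k j<2^k = subst (j + 2 ^ k <_) (cong (2 ^ k +_) (sym (+-identityʳ (2 ^ k)))) (+-monoˡ-< (2 ^ k) j<2^k)

overwriteAt : ∀ {A : Set} → List A → ℕ → A → List A
overwriteAt []      _       a = []
overwriteAt (_ ∷ x) zero    a = a ∷ x
overwriteAt (b ∷ x) (suc q) a = b ∷ overwriteAt x q a

length-overwriteAt : ∀ {A : Set} (x : List A) q a → length (overwriteAt x q a) ≡ length x
length-overwriteAt []      q       a = refl
length-overwriteAt (_ ∷ x) zero    a = refl
length-overwriteAt (_ ∷ x) (suc q) a = cong suc (length-overwriteAt x q a)

cellAt-overwriteAt-≢ : ∀ {A : Set} (x : List A) q a p → p ≢ q → cellAt x p ≡ cellAt (overwriteAt x q a) p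
cellAt-overwriteAt-≢ []      q       a p       p≢q = refl
cellAt-overwriteAt-≢ (_ ∷ x) zero    a zero    p≢q = ⊥-elim (p≢q refl)
cellAt-overwriteAt-≢ (_ ∷ x) zero    a (suc p) p≢q = refl
cellAt-overwriteAt-≢ (_ ∷ x) (suc q) a zero    p≢q = refl
cellAt-overwriteAt-≢ (_ ∷ x) (suc q) a (suc p) p≢q = cellAt-overwriteAt-≢ x q a p (λ p≡q → p≢q (cong suc p≡q))

cellAt-overwriteAt-≡ : ∀ {A : Set} (x : List A) q a → q < length x → cellAt (overwriteAt x q a) q ≡ just a
cellAt-overwriteAt-≡ (_ ∷ x) zero    a _         = refl
cellAt-overwriteAt-≡ (_ ∷ x) (suc q) a (s≤s q<n) = cellAt-overwriteAt-≡ x q a q<n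

cellAt-replicate : ∀ {A : Set} n (a : A) p → p < n → cellAt (List.replicate n a) p ≡ just a
cellAt-replicate (suc n) a zero    _         = refl
cellAt-replicate (suc n) a (suc p) (s≤s p<n) = cellAt-replicate n a p p<n

module Separation (w : ℕ) where
  open Clocked w
  open Run machine
  open RunProperties machine

  timeBound : ℕ → ℕ
  timeBound R = 5 + (R + 2) * R + suc R ^ d

  timeBound-mono : ∀ {a b} → a ≤ b → timeBound a ≤ timeBound b
  timeBound-mono a≤b = +-mono-≤ (+-monoʳ-≤ 5 (*-mono-≤ (+-monoˡ-≤ 2 a≤b) a≤b)) (^-monoˡ-≤ d (s≤s a≤b))

  budget : ℕ → ℕ
  budget n = timeBound (suc ⌊log₂ n ⌋)

  halts-within-budget : ∀ x → Σ ℕ λ H → Σ Bool λ b → result x H ≡ just b × H ≤ budget (length x)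
  halts-within-budget x with phase₁ x
  ... | R′ , T₁ , at , brackets , T₁≤ with Phase₂.phase₂-halts (suc R′) x (run x T₁ (init x)) (2 ^ R′) at
  ... | b , halted = T₁ + suc P , b , trans (cong verdict (run-+ x T₁ (suc P) (init x))) halted , H≤
    where
    P = Phase₂.P (suc R′)
    regroup : ∀ a p → 4 + a + suc p ≡ 5 + a + p
    regroup = solve-∀
    H≤ : T₁ + suc P ≤ budget (length x)
    H≤ = ≤-trans (≤-trans (+-monoˡ-≤ (suc P) T₁≤) (≤-reflexive (regroup _ P)))
                 (timeBound-mono (s≤s (Brackets⇒≤⌊log₂⌋ brackets)))

  -- The separating problem is the language of the machine; the cut-off after budget n steps
  -- never applies, because the machine always halts by then.
  language : Problem 2
  language x = fromMaybe false (result x (budget (length x)))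

  language-correct : ∀ x → result x (budget (length x)) ≡ just (language x)
  language-correct x with halts-within-budget x
  ... | H , b , halted , H≤ = trans on-time (cong just (sym (cong (fromMaybe false) on-time)))
    where
    on-time : result x (budget (length x)) ≡ just b
    on-time = result-mono x halted H≤

  language-result : ∀ x {t b} → result x t ≡ just b → language x ≡ b
  language-result x {t} {b} halted = result-unique x {budget (length x)} {t} {language x} {b} (language-correct x) halted

  language∈PL : 1 ≤ w → PL d language
  language∈PL 1≤w = machine , (λ x → budget (length x) , language-correct x) , 13 + 3 ^ d , 2 , λ x 2≤n →
    result-mono x {budget (length x)} (language-correct x)
      (polylog-bound d ⌊log₂ length x ⌋ (1≤⌊log₂⌋ 2≤n) (s≤s 1≤w))

  reaches-window : ∀ x k → length x ≡ 2 ^ suc k → Σ ℕ λ T₁ → Ready (suc k) (2 ^ k) (run x T₁ (init x))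
  reaches-window x k ∣x∣≡ with phase₁ x
  ... | R′ , T₁ , at , brackets , _ with Brackets-2^ {R′} {k} (subst (Brackets R′) ∣x∣≡ brackets)
  ... | refl = T₁ , at

  ones : ℕ → List (Fin 2)
  ones k = List.replicate (2 ^ suc k) bit1

  length-ones : ∀ k → length (ones k) ≡ 2 ^ suc k
  length-ones k = length-replicate (2 ^ suc k)

  -- On inputs of length 2 ^ (1 + k) the clock scans the window [2 ^ k, 2 ^ k + (2 + k) ^ d).
  module Window (k : ℕ) (P≤2^k : (2 + k) ^ d ≤ 2 ^ k) where
    open Phase₂ (suc k) using (P; phase₂-accepts; phase₂-rejects)

    inside : ∀ {j} → j < P → j + 2 ^ k < 2 ^ suc k
    inside j<P = +2^k<2^[1+k] k (<-≤-trans j<P P≤2^k)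

    cellAt-ones : ∀ {j} → j < P → cellAt (ones k) (j + 2 ^ k) ≡ just bit1
    cellAt-ones j<P = cellAt-replicate (2 ^ suc k) bit1 _ (inside j<P)

    ones-accepted : language (ones k) ≡ true
    ones-accepted with reaches-window (ones k) k (length-ones k)
    ... | T₁ , at = language-result (ones k) {T₁ + suc P}
      (trans (cong verdict (run-+ (ones k) T₁ (suc P) (init (ones k))))
      (phase₂-accepts (ones k) (run (ones k) T₁ (init (ones k))) (2 ^ k) at (λ j → cellAt-ones)))

    zero-rejected : ∀ t → t < P → language (overwriteAt (ones k) (t + 2 ^ k) bit0) ≡ false
    zero-rejected t t<P with reaches-window y k (trans (length-overwriteAt (ones k) (t + 2 ^ k) bit0) (length-ones k))
      where y = overwriteAt (ones k) (t + 2 ^ k) bit0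
    ... | T₁ , at = language-result y {T₁ + suc t} (trans (cong verdict (run-+ y T₁ (suc t) (init y)))
      (phase₂-rejects y (run y T₁ (init y)) (2 ^ k) t at t<P ones-before zero-at))
      where
      y = overwriteAt (ones k) (t + 2 ^ k) bit0
      ones-before : ∀ j → j < t → cellAt y (j + 2 ^ k) ≡ just bit1
      ones-before j j<t = trans (sym (cellAt-overwriteAt-≢ (ones k) (t + 2 ^ k) bit0 (j + 2 ^ k)
                                   (λ eq → <-irrefl (+-cancelʳ-≡ (2 ^ k) j t eq) j<t)))
                                (cellAt-ones (<-trans j<t t<P))
      zero-at : cellAt y (t + 2 ^ k) ≡ just bit0
      zero-at = cellAt-overwriteAt-≡ (ones k) (t + 2 ^ k) bit0 (subst (t + 2 ^ k <_) (sym (length-ones k)) (inside t<P))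

  language-sensitive : SensitiveBeyond w language
  language-sensitive c N with large-scale d c N
  ... | k , c<1+k , N≤2^[1+k] , P≤2^k =
    ones k , subst (N ≤_) (sym (length-ones k)) N≤2^[1+k] , 2 ^ k , suc k ^ d , budget<K , flip
    where
    open Window k P≤2^k
    budget<K : c * ⌊log₂ length (ones k) ⌋ ^ w < suc k ^ d
    budget<K rewrite length-ones k | ⌊log₂[2^n]⌋≡n (suc k) = *-monoˡ-< (suc k ^ w) {{m^n≢0 (suc k) w}} c<1+k
    flip : ∀ t → t < suc k ^ d → Σ (List (Fin 2)) λ y →
             length y ≡ length (ones k) × ¬ language y ≡ language (ones k) ×
             (∀ p → p ≢ t + 2 ^ k → cellAt (ones k) p ≡ cellAt y p)
    flip t t<K = overwriteAt (ones k) (t + 2 ^ k) bit0 , length-overwriteAt (ones k) (t + 2 ^ k) bit0 ,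
                 (λ eq → false≢true (trans (sym (zero-rejected t t<P)) (trans eq ones-accepted))) ,
                 cellAt-overwriteAt-≢ (ones k) (t + 2 ^ k) bit0
      where
      t<P : t < (2 + k) ^ d
      t<P = <-≤-trans t<K (^-monoˡ-≤ d (n≤1+n (suc k)))
      false≢true : false ≢ true
      false≢true ()

theorem2 : (i : ℕ) → 1 ≤ i →
    ((s : ℕ) (P : Problem s) → PL i P → PL (suc i) P)
    × Σ ℕ (λ s → Σ (Problem s) (λ P → PL (suc i) P × ¬ PL i P))
theorem2 i 1≤i =
  (λ s P → PL⊆PL-suc i P) ,
  2 , language , language∈PL 1≤i , SensitiveBeyond⇒¬PL i language language-sensitive
  where open Separation i
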